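{- Let $d\ge 2$, $n\ge d$ and $k\ge 1$ be integers, and put $c=\left\lceil n/\sum_{j=0}^k d^j\right\rceil$. Suppose there exist a vertex $x\in\{0,\dots,n-1\}$ of $G_B(n,d)$ and an integer $h$ with $$(d-1)x\equiv c-h \pmod n \qquad\text{and}\qquad 0\le \Big(\sum_{j=0}^{k-1} d^j\Big)h \le \Big(\sum_{j=0}^k d^j\Big)c - n.$$ Then $\gamma_k(G_B(n,d)) = c$, and $D=\{x,x+1,\dots,x+c-1\}$ (taken modulo $n$) is a minimum distance $k$-dominating set of $G_B(n,d)$.
   Context: The generalized de Bruijn digraph $G_B(n,d)$ has vertex set $\{0,1,\dots,n-1\}$ and an arc $(x,y)$ whenever $y\equiv dx+i \pmod n$ for some $0\le i\le d-1$ (self-loops allowed). A set $D\subseteq V(G)$ of a digraph $G$ is a distance $k$-dominating set if every vertex $v\notin D$ has some $u\in D$ with a directed path from $u$ to $v$ of length at most $k$. $\gamma_k(G)$ denotes the minimum cardinality of a distance $k$-dominating set of $G$. -}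

module Defs where

open import Data.Nat using (ℕ; zero; suc; _+_; _*_; _∸_; _^_; _<_; _≤_; _%_; _/_; NonZero)
open import Data.Nat.Base using (_≡ᵇ_)
open import Data.Bool using (Bool; false; _∨_)
open import Data.Fin using (Fin; toℕ)
open import Data.Fin.Subset using (Subset; _∈_; _∉_)
open import Data.Vec using (tabulate)
open import Data.Product using (Σ; ∃; _×_)
open import Relation.Binary.PropositionalEquality using (_≡_)

_mod_ : ℕ → ℕ → ℕ
a mod zero = a
a mod suc m = a % suc m

geomSum : ℕ → ℕ → ℕ
geomSum d zero = 1
geomSum d (suc k) = geomSum d k + d ^ suc k

-- ⌈ a / b ⌉ (convention: ⌈ a / 0 ⌉ = 0, never used since geomSum ≥ 1)
ceilDiv : ℕ → ℕ → ℕ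
ceilDiv a zero = 0
ceilDiv a (suc m) = (a + m) / suc m

-- arcs of the generalized de Bruijn digraph G_B(n,d): x → y iff y ≡ d x + i (mod n), 0 ≤ i ≤ d-1
Arc : (n d : ℕ) → Fin n → Fin n → Set
Arc n d x y = Σ ℕ λ i → i < d × toℕ y ≡ (d * toℕ x + i) mod n

-- Walk n d k u v : there is a directed walk from u to v of length at most k
data Walk (n d : ℕ) : ℕ → Fin n → Fin n → Set where
  here : ∀ {k u} → Walk n d k u u
  step : ∀ {k u w v} → Arc n d u w → Walk n d k w v → Walk n d (suc k) u v

IsDistDom : (n d k : ℕ) → Subset n → Set
IsDistDom n d k D = ∀ v → v ∉ D → Σ (Fin n) λ u → u ∈ D × Walk n d k u v

open Data.Fin.Subset using (∣_∣)
GammaEq : (n d k c : ℕ) → Set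
GammaEq n d k c =
  (Σ (Subset n) λ D → IsDistDom n d k D × ∣ D ∣ ≡ c)
  × (∀ D → IsDistDom n d k D → c ≤ ∣ D ∣)

IsMinDistDom : (n d k : ℕ) → Subset n → Set
IsMinDistDom n d k D = IsDistDom n d k D × (∀ D' → IsDistDom n d k D' → ∣ D ∣ ≤ ∣ D' ∣)

anyBelow : ℕ → (ℕ → Bool) → Bool
anyBelow zero p = false
anyBelow (suc c) p = anyBelow c p ∨ p c

interval : (n : ℕ) → ℕ → ℕ → Subset n
interval n x c = tabulate λ v → anyBelow c λ j → ((x + j) mod n) ≡ᵇ toℕ v

-- Write B k = Σ_{j<k} d^j and S k = Σ_{j≤k} d^j, so S k = 1 + d·B k.  The vertices at
-- distance exactly j from u are d^j u + t with t < d^j, so a vertex dominates at most S k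
-- vertices and every distance k-dominating set has at least ⌈n/S k⌉ = c elements.
-- Conversely, d x + h ≡ x + c gives d^j x + B j·h ≡ x + B j·c by induction on j, so the
-- vertices at distance exactly j from D = {x, …, x+c-1} form the window of length d^j c
-- starting at x + B j·(c - h).  Consecutive windows overlap or abut because h ≥ 0, and the
-- last one ends at x + S k·c - B k·h ≥ x + n, so the windows cover all residues mod n.
module Submission where

open import Defs
open import Data.Bool using (Bool; true; T)
open import Data.Bool.Properties using (T-≡; T-∨)
open import Data.Empty using (⊥-elim)
open import Data.Fin using (Fin; toℕ) renaming (zero to fzero; suc to fsuc)
open import Data.Fin.Properties using (toℕ-fromℕ<; toℕ-injective; toℕ<n)
open import Data.Fin.Subset using (Subset; inside; outside; ∣_∣; ⊤) renaming (_∈_ to _∈ₛ_)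
open import Data.Fin.Subset.Properties using (∣⊤∣≡n; _∈?_)
open import Data.Integer using (ℤ; +_; -[1+_]; _-_; _*_)
import Data.Integer as ℤ
open import Data.Integer.Divisibility using (_∣_)
open import Data.Integer.Properties
  using (pos-+; pos-*; ∣⊖∣-≤; ∣m⊖n∣≡∣n⊖m∣; [+m]-[+n]≡m⊖n; drop‿+≤+; +-monoˡ-≤)
open import Data.Integer.Tactic.RingSolver using () renaming (solve-∀ to ℤ-solve-∀)
open import Data.List using (List; []; _∷_; [_]; map; upTo; length; _++_; cartesianProductWith)
open import Data.List.Properties using (length-map; length-++; length-upTo)
open import Data.List.Membership.Propositional using () renaming (_∈_ to _∈ₗ_)
open import Data.List.Membership.Propositional.Properties
  using (∈-map⁺; ∈-++⁺ˡ; ∈-++⁺ʳ; ∈-upTo⁺; ∈-cartesianProductWith⁺)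
open import Data.List.Relation.Unary.Any using (here; there)
open import Data.Nat
  using (ℕ; zero; suc; _+_; _∸_; _^_; _≤_; _<_; z≤n; s≤s; NonZero; _%_; _/_; _≡ᵇ_)
  renaming (_*_ to _·_)
open import Data.Nat.DivMod
  using (m%n%n≡m%n; %-distribˡ-+; %-distribˡ-*; [m+n]%n≡m%n; [m+kn]%n≡m%n; m%n<n; m≡m%n+[m/n]*n; m<n*o⇒m/o<n; m<n⇒m%n≡m)
  renaming (_mod_ to _modᶠ_)
open import Data.Nat.Divisibility using (divides) renaming (_∣_ to _∣ₙ_)
import Data.Nat.Properties as ℕ
open import Data.Nat.Tactic.RingSolver using (solve-∀)
open import Data.Product using (_×_; ∃; _,_; uncurry)
open import Data.Sum using (inj₁; inj₂)
open import Data.Vec using (lookup) renaming (_∷_ to _∷ᵥ_; [] to []ᵥ)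
open import Data.Vec.Properties using (lookup∘tabulate; lookup⇒[]=; []=⇒lookup)
open import Function.Bundles using (Equivalence)
open import Relation.Binary.Bundles using (Setoid)
open import Relation.Binary.PropositionalEquality hiding ([_])
import Relation.Binary.Reasoning.Setoid as SetoidReasoning
open import Relation.Nullary using (¬_; yes; no)

open Data.Vec._[_]=_ renaming (here to vhere; there to vthere)
open Equivalence using (to; from)

mixedRadix-< : ∀ {d e i t} → i < d → t < e → e · i + t < d · e
mixedRadix-< {d} {e} {i} {t} i<d t<e = begin-strict
  e · i + t   <⟨ ℕ.+-monoʳ-< (e · i) t<e ⟩
  e · i + e   ≡⟨ ℕ.+-comm (e · i) e ⟩
  e + e · i   ≡⟨ ℕ.*-suc e i ⟨
  e · suc i   ≤⟨ ℕ.*-monoʳ-≤ e i<d ⟩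
  e · d       ≡⟨ ℕ.*-comm e d ⟩
  d · e       ∎
  where open ℕ.≤-Reasoning

geomSumBelow : ℕ → ℕ → ℕ
geomSumBelow d zero = 0
geomSumBelow d (suc k) = geomSum d k

geomSum-suc : ∀ d k → geomSum d (suc k) ≡ suc (d · geomSum d k)
geomSum-suc d zero = refl
geomSum-suc d (suc k) = begin
  geomSum d (suc k) + d · d ^ suc k     ≡⟨ cong (_+ d · d ^ suc k) (geomSum-suc d k) ⟩
  suc (d · geomSum d k + d · d ^ suc k) ≡⟨ cong suc (ℕ.*-distribˡ-+ d (geomSum d k) (d ^ suc k)) ⟨
  suc (d · geomSum d (suc k))           ∎
  where open ≡-Reasoning

geomSum≡1+d*geomSumBelow : ∀ d k → geomSum d k ≡ suc (d · geomSumBelow d k)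
geomSum≡1+d*geomSumBelow d zero = cong suc (sym (ℕ.*-zeroʳ d))
geomSum≡1+d*geomSumBelow d (suc k) = geomSum-suc d k

geomSumBelow≤geomSum : ∀ d k → geomSumBelow d k ≤ geomSum d k
geomSumBelow≤geomSum d zero = z≤n
geomSumBelow≤geomSum d (suc k) = ℕ.m≤m+n (geomSum d k) _

geomSum-positive : ∀ d k → 1 ≤ geomSum d k
geomSum-positive d k = subst (1 ≤_) (sym (geomSum≡1+d*geomSumBelow d k)) (s≤s z≤n)

module Congruence (N : ℕ) .{{_ : NonZero N}} where

  infix 4 _≋_
  record _≋_ (a b : ℕ) : Set where
    constructor mk≋
    field ≋⇒%≡ : a % N ≡ b % N
  open _≋_ public

  ≋-reflexive : ∀ {a b} → a ≡ b → a ≋ b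
  ≋-reflexive a≡b = mk≋ (cong (_% N) a≡b)

  ≋-setoid : Setoid _ _
  ≋-setoid = record
    { Carrier = ℕ
    ; _≈_ = _≋_
    ; isEquivalence = record
      { refl = mk≋ refl
      ; sym = λ a≋b → mk≋ (sym (≋⇒%≡ a≋b))
      ; trans = λ a≋b b≋c → mk≋ (trans (≋⇒%≡ a≋b) (≋⇒%≡ b≋c))
      }
    }

  module ≋-Reasoning = SetoidReasoning ≋-setoid
  open Setoid ≋-setoid public using () renaming (sym to ≋-sym; trans to ≋-trans)

  %-≋ : ∀ a → a % N ≋ a
  %-≋ a = mk≋ (m%n%n≡m%n a N)

  +-congʳ : ∀ {a b} c → a ≋ b → a + c ≋ b + c
  +-congʳ {a} {b} c a≋b = mk≋ (begin
    (a + c) % N             ≡⟨ %-distribˡ-+ a c N ⟩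
    (a % N + c % N) % N     ≡⟨ cong (λ r → (r + c % N) % N) (≋⇒%≡ a≋b) ⟩
    (b % N + c % N) % N     ≡⟨ %-distribˡ-+ b c N ⟨
    (b + c) % N             ∎)
    where open ≡-Reasoning

  +-congˡ : ∀ {a b} c → a ≋ b → c + a ≋ c + b
  +-congˡ {a} {b} c a≋b = begin
    c + a ≡⟨ ℕ.+-comm c a ⟩
    a + c ≈⟨ +-congʳ c a≋b ⟩
    b + c ≡⟨ ℕ.+-comm b c ⟩
    c + b ∎
    where open ≋-Reasoning

  *-congˡ : ∀ {a b} c → a ≋ b → c · a ≋ c · b
  *-congˡ {a} {b} c a≋b = mk≋ (begin
    (c · a) % N             ≡⟨ %-distribˡ-* c a N ⟩
    (c % N · (a % N)) % N   ≡⟨ cong (λ r → (c % N · r) % N) (≋⇒%≡ a≋b) ⟩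
    (c % N · (b % N)) % N   ≡⟨ %-distribˡ-* c b N ⟨
    (c · b) % N             ∎)
    where open ≡-Reasoning

  +-multiple-≋ : ∀ a q → a + q · N ≋ a
  +-multiple-≋ a q = mk≋ ([m+kn]%n≡m%n a q N)

  ∸-∣⇒≋ : ∀ {a b} → b ≤ a → N ∣ₙ a ∸ b → a ≋ b
  ∸-∣⇒≋ {a} {b} b≤a (divides q a∸b≡qN) = begin
    a             ≡⟨ ℕ.m+[n∸m]≡n b≤a ⟨
    b + (a ∸ b)   ≡⟨ cong (_+_ b) a∸b≡qN ⟩
    b + q · N     ≈⟨ +-multiple-≋ b q ⟩
    b             ∎
    where open ≋-Reasoning

  +-complement : ∀ c → c + (N ∸ c % N) ≡ suc (c / N) · N
  +-complement c = begin
    c + c′                   ≡⟨ cong (_+ c′) (m≡m%n+[m/n]*n c N) ⟩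
    c % N + c / N · N + c′   ≡⟨ regroup (c % N) (c / N · N) c′ ⟩
    c / N · N + (c % N + c′) ≡⟨ cong (_+_ (c / N · N)) (ℕ.m+[n∸m]≡n (ℕ.<⇒≤ (m%n<n c N))) ⟩
    c / N · N + N            ≡⟨ ℕ.+-comm (c / N · N) N ⟩
    suc (c / N) · N          ∎
    where
    open ≡-Reasoning
    c′ = N ∸ c % N
    regroup : ∀ r s t → r + s + t ≡ s + (r + t)
    regroup = solve-∀

  +-cancelʳ : ∀ {a b} c → a + c ≋ b + c → a ≋ b
  +-cancelʳ {a} {b} c a+c≋b+c = begin
    a                          ≈⟨ +-multiple-≋ a (suc (c / N)) ⟨
    a + suc (c / N) · N        ≡⟨ cong (_+_ a) (+-complement c) ⟨
    a + (c + (N ∸ c % N))      ≡⟨ ℕ.+-assoc a c (N ∸ c % N) ⟨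
    a + c + (N ∸ c % N)        ≈⟨ +-congʳ (N ∸ c % N) a+c≋b+c ⟩
    b + c + (N ∸ c % N)        ≡⟨ ℕ.+-assoc b c (N ∸ c % N) ⟩
    b + (c + (N ∸ c % N))      ≡⟨ cong (_+_ b) (+-complement c) ⟩
    b + suc (c / N) · N        ≈⟨ +-multiple-≋ b (suc (c / N)) ⟩
    b                          ∎
    where open ≋-Reasoning

  infixl 6 _∸ₘ_
  _∸ₘ_ : ℕ → ℕ → ℕ
  a ∸ₘ b = (a + (N ∸ b)) % N

  ∸ₘ-< : ∀ a b → a ∸ₘ b < N
  ∸ₘ-< a b = m%n<n (a + (N ∸ b)) N

  +-∸ₘ : ∀ a {b} → b ≤ N → b + (a ∸ₘ b) ≋ a
  +-∸ₘ a {b} b≤N = begin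
    b + (a + (N ∸ b)) % N   ≈⟨ +-congˡ b (%-≋ (a + (N ∸ b))) ⟩
    b + (a + (N ∸ b))       ≡⟨ regroup b a (N ∸ b) ⟩
    a + (b + (N ∸ b))       ≡⟨ cong (_+_ a) (ℕ.m+[n∸m]≡n b≤N) ⟩
    a + N                   ≈⟨ mk≋ ([m+n]%n≡m%n a N) ⟩
    a                       ∎
    where
    open ≋-Reasoning
    regroup : ∀ b a c → b + (a + c) ≡ a + (b + c)
    regroup = solve-∀

  ∣-⇒≋ : ∀ {a b} → + N ∣ + a - + b → a ≋ b
  ∣-⇒≋ {a} {b} N∣a-b with ℕ.≤-total b a
  ... | inj₁ b≤a = ∸-∣⇒≋ b≤a (subst (N ∣ₙ_) ∣a-b∣≡a∸b N∣a-b)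
    where
    ∣a-b∣≡a∸b : ℤ.∣ + a - + b ∣ ≡ a ∸ b
    ∣a-b∣≡a∸b = trans (cong ℤ.∣_∣ ([+m]-[+n]≡m⊖n a b)) (trans (∣m⊖n∣≡∣n⊖m∣ a b) (∣⊖∣-≤ b≤a))
  ... | inj₂ a≤b = ≋-sym (∸-∣⇒≋ a≤b (subst (N ∣ₙ_) ∣a-b∣≡b∸a N∣a-b))
    where
    ∣a-b∣≡b∸a : ℤ.∣ + a - + b ∣ ≡ b ∸ a
    ∣a-b∣≡b∸a = trans (cong ℤ.∣_∣ ([+m]-[+n]≡m⊖n a b)) (∣⊖∣-≤ a≤b)

  ∣-shift⇒≋ : ∀ d x c h → + N ∣ + d * + x - (+ c - + h) → suc d · x + h ≋ x + c
  ∣-shift⇒≋ d x c h N∣shift = begin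
    suc d · x + h    ≡⟨ ℕ.+-assoc x (d · x) h ⟩
    x + (d · x + h)  ≈⟨ +-congˡ x (∣-⇒≋ (subst (+ N ∣_) shift≡ N∣shift)) ⟩
    x + c            ∎
    where
    open ≋-Reasoning
    regroup : ∀ a c h → a - (c - h) ≡ a ℤ.+ h - c
    regroup = ℤ-solve-∀
    shift≡ : + d * + x - (+ c - + h) ≡ + (d · x + h) - + c
    shift≡ = trans (regroup (+ d * + x) (+ c) (+ h))
      (cong (_- + c) (sym (trans (pos-+ (d · x) h) (cong (ℤ._+ + h) (pos-* d x)))))

  toℕ-modᶠ : ∀ a → toℕ (a modᶠ N) ≡ a % N
  toℕ-modᶠ a = toℕ-fromℕ< (m%n<n a N)

  toℕ-modᶠ-≋ : ∀ a → toℕ (a modᶠ N) ≋ a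
  toℕ-modᶠ-≋ a = ≋-trans (≋-reflexive (toℕ-modᶠ a)) (%-≋ a)

  modᶠ-toℕ : ∀ (u : Fin N) → toℕ u modᶠ N ≡ u
  modᶠ-toℕ u = toℕ-injective (trans (toℕ-modᶠ (toℕ u)) (m<n⇒m%n≡m (toℕ<n u)))

  modᶠ-cong : ∀ {a b} → a ≋ b → a modᶠ N ≡ b modᶠ N
  modᶠ-cong {a} {b} a≋b = toℕ-injective (trans (toℕ-modᶠ a) (trans (≋⇒%≡ a≋b) (sym (toℕ-modᶠ b))))

module Orbit (N : ℕ) .{{_ : NonZero N}} (d x h c : ℕ) (shift : Congruence._≋_ N (d · x + h) (x + c)) where
  open Congruence N

  orbit : ∀ k → d ^ k · x + geomSumBelow d k · h ≋ x + geomSumBelow d k · c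
  orbit zero = ≋-reflexive (ℕ.+-identityʳ (x + 0))
  orbit (suc k) = begin
    d · e · x + geomSum d k · h  ≡⟨ cong (λ s → d · e · x + s · h) (geomSum≡1+d*geomSumBelow d k) ⟩
    d · e · x + suc (d · b) · h  ≡⟨ regroup₁ d e x b h ⟩
    d · (e · x + b · h) + h      ≈⟨ +-congʳ h (*-congˡ d (orbit k)) ⟩
    d · (x + b · c) + h          ≡⟨ regroup₂ d x b c h ⟩
    d · x + h + d · b · c        ≈⟨ +-congʳ (d · b · c) shift ⟩
    x + c + d · b · c            ≡⟨ regroup₃ d x b c ⟩
    x + suc (d · b) · c          ≡⟨ cong (λ s → x + s · c) (geomSum≡1+d*geomSumBelow d k) ⟨
    x + geomSum d k · c          ∎
    where
    open ≋-Reasoning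
    e = d ^ k
    b = geomSumBelow d k
    regroup₁ : ∀ d e x b h → d · e · x + suc (d · b) · h ≡ d · (e · x + b · h) + h
    regroup₁ = solve-∀
    regroup₂ : ∀ d x b c h → d · (x + b · c) + h ≡ d · x + h + d · b · c
    regroup₂ = solve-∀
    regroup₃ : ∀ d x b c → x + c + d · b · c ≡ x + suc (d · b) · c
    regroup₃ = solve-∀

  -- Either an earlier window d^j x + [0, d^j c) already contains x + r, or orbit (k + 1)
  -- puts it into the window with j = k + 1.
  cover : ∀ k r → r + geomSumBelow d k · h < geomSum d k · c →
          ∃ λ j → j ≤ k × ∃ λ s → s < d ^ j · c × x + r ≋ d ^ j · x + s
  cover zero r r<c = 0 , z≤n , r , subst (_< 1 · c) (ℕ.+-identityʳ r) r<c ,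
    ≋-reflexive (cong (_+ r) (sym (ℕ.+-identityʳ x)))
  cover (suc k) r bound with r + geomSumBelow d k · h ℕ.<? geomSum d k · c
  ... | yes earlier = let j , j≤k , rest = cover k r earlier in j , ℕ.m≤n⇒m≤1+n j≤k , rest
  ... | no later = suc k , ℕ.≤-refl , s , s<dᵏ⁺¹c , x+r≋dᵏ⁺¹x+s
    where
    A = geomSum d k · c
    z = geomSum d k · h
    A≤r+z : A ≤ r + z
    A≤r+z = ℕ.≤-trans (ℕ.≮⇒≥ later) (ℕ.+-monoʳ-≤ r (ℕ.*-monoˡ-≤ h (geomSumBelow≤geomSum d k)))
    s = r + z ∸ A
    s+A≡r+z : s + A ≡ r + z
    s+A≡r+z = ℕ.m∸n+n≡m A≤r+z
    s<dᵏ⁺¹c : s < d ^ suc k · c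
    s<dᵏ⁺¹c = ℕ.+-cancelʳ-< A s (d ^ suc k · c) (subst₂ _<_ (sym s+A≡r+z) S[k+1]c≡ bound)
      where
      S[k+1]c≡ : geomSum d (suc k) · c ≡ d ^ suc k · c + A
      S[k+1]c≡ = trans (ℕ.*-distribʳ-+ c (geomSum d k) (d ^ suc k)) (ℕ.+-comm A (d ^ suc k · c))
    x+r≋dᵏ⁺¹x+s : x + r ≋ d ^ suc k · x + s
    x+r≋dᵏ⁺¹x+s = +-cancelʳ z (begin
      x + r + z              ≡⟨ ℕ.+-assoc x r z ⟩
      x + (r + z)            ≡⟨ cong (_+_ x) s+A≡r+z ⟨
      x + (s + A)            ≡⟨ regroup₁ x s A ⟩
      x + A + s              ≈⟨ +-congʳ s (orbit (suc k)) ⟨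
      d ^ suc k · x + z + s  ≡⟨ regroup₂ (d ^ suc k · x) z s ⟩
      d ^ suc k · x + s + z  ∎)
      where
      open ≋-Reasoning
      regroup₁ : ∀ x s A → x + (s + A) ≡ x + A + s
      regroup₁ = solve-∀
      regroup₂ : ∀ y z s → y + z + s ≡ y + s + z
      regroup₂ = solve-∀

anyBelow⁺ : ∀ {c} (p : ℕ → Bool) {q} → q < c → T (p q) → T (anyBelow c p)
anyBelow⁺ {suc c} p (s≤s q≤c) pq with ℕ.m≤n⇒m<n∨m≡n q≤c
... | inj₁ q<c = from T-∨ (inj₁ (anyBelow⁺ p q<c pq))
... | inj₂ refl = from T-∨ (inj₂ pq)

anyBelow⁻ : ∀ c (p : ℕ → Bool) → T (anyBelow c p) → ∃ λ q → q < c × T (p q)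
anyBelow⁻ (suc c) p any with to T-∨ any
... | inj₁ earlier = let q , q<c , pq = anyBelow⁻ c p earlier in q , ℕ.m<n⇒m<1+n q<c , pq
... | inj₂ pc = c , ℕ.n<1+n c , pc

length-cartesianProductWith : ∀ {A B C : Set} (f : A → B → C) xs ys →
  length (cartesianProductWith f xs ys) ≡ length xs · length ys
length-cartesianProductWith f [] ys = refl
length-cartesianProductWith f (x ∷ xs) ys = trans (length-++ (map (f x) ys))
  (cong₂ _+_ (length-map (f x) ys) (length-cartesianProductWith f xs ys))

members : ∀ {n} → Subset n → List (Fin n)
members []ᵥ = []
members (inside ∷ᵥ p) = fzero ∷ map fsuc (members p)
members (outside ∷ᵥ p) = map fsuc (members p)

length-members : ∀ {n} (p : Subset n) → length (members p) ≡ ∣ p ∣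
length-members []ᵥ = refl
length-members (inside ∷ᵥ p) = cong suc (trans (length-map fsuc (members p)) (length-members p))
length-members (outside ∷ᵥ p) = trans (length-map fsuc (members p)) (length-members p)

∈-members : ∀ {n} {p : Subset n} {v} → v ∈ₛ p → v ∈ₗ members p
∈-members {p = inside ∷ᵥ p} vhere = here refl
∈-members {p = inside ∷ᵥ p} (vthere v∈p) = there (∈-map⁺ fsuc (∈-members v∈p))
∈-members {p = outside ∷ᵥ p} (vthere v∈p) = ∈-map⁺ fsuc (∈-members v∈p)

unsucs : ∀ {n} → List (Fin (suc n)) → List (Fin n)
unsucs [] = []
unsucs (fzero ∷ vs) = unsucs vs
unsucs (fsuc v ∷ vs) = v ∷ unsucs vs

∈-unsucs : ∀ {n} {vs : List (Fin (suc n))} {v} → fsuc v ∈ₗ vs → v ∈ₗ unsucs vs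
∈-unsucs {vs = fsuc _ ∷ vs} (here refl) = here refl
∈-unsucs {vs = fzero ∷ vs} (there v∈vs) = ∈-unsucs v∈vs
∈-unsucs {vs = fsuc _ ∷ vs} (there v∈vs) = there (∈-unsucs v∈vs)

length-unsucs-≤ : ∀ {n} (vs : List (Fin (suc n))) → length (unsucs vs) ≤ length vs
length-unsucs-≤ [] = z≤n
length-unsucs-≤ (fzero ∷ vs) = ℕ.m≤n⇒m≤1+n (length-unsucs-≤ vs)
length-unsucs-≤ (fsuc _ ∷ vs) = s≤s (length-unsucs-≤ vs)

length-unsucs-< : ∀ {n} {vs : List (Fin (suc n))} → fzero ∈ₗ vs → length (unsucs vs) < length vs
length-unsucs-< {vs = fzero ∷ vs} (here refl) = s≤s (length-unsucs-≤ vs)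
length-unsucs-< {vs = fzero ∷ vs} (there 0∈vs) = ℕ.m<n⇒m<1+n (length-unsucs-< 0∈vs)
length-unsucs-< {vs = fsuc _ ∷ vs} (there 0∈vs) = s≤s (length-unsucs-< 0∈vs)

∣p∣≤length : ∀ {n} (p : Subset n) (vs : List (Fin n)) → (∀ {v} → v ∈ₛ p → v ∈ₗ vs) → ∣ p ∣ ≤ length vs
∣p∣≤length []ᵥ vs p⊆vs = z≤n
∣p∣≤length (inside ∷ᵥ p) vs p⊆vs =
  ℕ.≤-trans (s≤s (∣p∣≤length p (unsucs vs) (λ v∈p → ∈-unsucs (p⊆vs (vthere v∈p))))) (length-unsucs-< (p⊆vs vhere))
∣p∣≤length (outside ∷ᵥ p) vs p⊆vs =
  ℕ.≤-trans (∣p∣≤length p (unsucs vs) (λ v∈p → ∈-unsucs (p⊆vs (vthere v∈p)))) (length-unsucs-≤ vs)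

offsets : ℕ → ℕ → List (ℕ × ℕ)
offsets d zero = [ (0 , 0) ]
offsets d (suc k) = offsets d k ++ map (suc k ,_) (upTo (d ^ suc k))

length-offsets : ∀ d k → length (offsets d k) ≡ geomSum d k
length-offsets d zero = refl
length-offsets d (suc k) = trans (length-++ (offsets d k))
  (cong₂ _+_ (length-offsets d k) (trans (length-map _ (upTo (d ^ suc k))) (length-upTo (d ^ suc k))))

∈-offsets : ∀ {d k j t} → j ≤ k → t < d ^ j → (j , t) ∈ₗ offsets d k
∈-offsets {k = zero} z≤n (s≤s z≤n) = here refl
∈-offsets {d} {suc k} j≤1+k t<dʲ with ℕ.m≤n⇒m<n∨m≡n j≤1+k
... | inj₁ (s≤s j≤k) = ∈-++⁺ˡ (∈-offsets j≤k t<dʲ)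
... | inj₂ refl = ∈-++⁺ʳ (offsets d k) (∈-map⁺ _ (∈-upTo⁺ t<dʲ))

walk-mono : ∀ {n d j k u v} → j ≤ k → Walk n d j u v → Walk n d k u v
walk-mono _ here = here
walk-mono (s≤s j≤k) (step arc walk) = step arc (walk-mono j≤k walk)

IsDistDom⇒reachable : ∀ {n d k D} → IsDistDom n d k D → ∀ v → ∃ λ u → u ∈ₛ D × Walk n d k u v
IsDistDom⇒reachable {D = D} dom v with v ∈? D
... | yes v∈D = v , v∈D , here
... | no v∉D = dom v v∉D

module DeBruijn (m d : ℕ) where
  N : ℕ
  N = suc m
  open Congruence N

  descendant : Fin N → ℕ → ℕ → Fin N
  descendant u j t = (d ^ j · toℕ u + t) modᶠ N

  descendant-zero : ∀ u → descendant u 0 0 ≡ u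
  descendant-zero u = trans (cong (_modᶠ N) (trans (ℕ.+-identityʳ (toℕ u + 0)) (ℕ.+-identityʳ (toℕ u))))
    (modᶠ-toℕ u)

  descendant-step : ∀ {u w : Fin N} {i} j t → toℕ w ≡ (d · toℕ u + i) % N →
                    descendant w j t ≡ descendant u (suc j) (d ^ j · i + t)
  descendant-step {u} {w} {i} j t w≡du+i = modᶠ-cong (begin
    e · toℕ w + t                  ≡⟨ cong (λ y → e · y + t) w≡du+i ⟩
    e · ((d · toℕ u + i) % N) + t  ≈⟨ +-congʳ t (*-congˡ e (%-≋ (d · toℕ u + i))) ⟩
    e · (d · toℕ u + i) + t        ≡⟨ regroup d e (toℕ u) i t ⟩
    d · e · toℕ u + (e · i + t)    ∎)
    where
    open ≋-Reasoning
    e = d ^ j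
    regroup : ∀ d e u i t → e · (d · u + i) + t ≡ d · e · u + (e · i + t)
    regroup = solve-∀

  walk⇒descendant : ∀ {k u v} → Walk N d k u v → ∃ λ j → j ≤ k × ∃ λ t → t < d ^ j × v ≡ descendant u j t
  walk⇒descendant {u = u} here = 0 , z≤n , 0 , s≤s z≤n , sym (descendant-zero u)
  walk⇒descendant (step (i , i<d , w≡du+i) walk) =
    let j , j≤k , t , t<dʲ , v≡ = walk⇒descendant walk
    in suc j , s≤s j≤k , d ^ j · i + t , mixedRadix-< i<d t<dʲ , trans v≡ (descendant-step j t w≡du+i)

  descendant-walk : .{{_ : NonZero d}} → ∀ u j {t} → t < d ^ j → Walk N d j u (descendant u j t)
  descendant-walk u zero (s≤s z≤n) = subst (Walk N d 0 u) (sym (descendant-zero u)) here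
  descendant-walk u (suc j) {t} t<dʲ⁺¹ =
    step (i , i<d , toℕ-modᶠ (d · toℕ u + i)) (subst (Walk N d j w) w→v (descendant-walk w j (m%n<n t e)))
    where
    e = d ^ j
    instance
      e≢0 : NonZero e
      e≢0 = ℕ.m^n≢0 d j
    i = t / e
    i<d : i < d
    i<d = m<n*o⇒m/o<n t<dʲ⁺¹
    w = (d · toℕ u + i) modᶠ N
    digits : e · i + t % e ≡ t
    digits = trans (ℕ.+-comm (e · i) (t % e))
      (trans (cong (_+_ (t % e)) (ℕ.*-comm e i)) (sym (m≡m%n+[m/n]*n t e)))
    w→v : descendant w j (t % e) ≡ descendant u (suc j) t
    w→v = trans (descendant-step j (t % e) (toℕ-modᶠ (d · toℕ u + i))) (cong (descendant u (suc j)) digits)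

  distDom-size : ∀ {k} (D : Subset N) → IsDistDom N d k D → N ≤ ∣ D ∣ · geomSum d k
  distDom-size {k} D dom = begin
    N                                          ≡⟨ ∣⊤∣≡n N ⟨
    ∣ ⊤ {N} ∣                                  ≤⟨ ∣p∣≤length ⊤ balls (λ {v} _ → covered v) ⟩
    length balls                               ≡⟨ length-cartesianProductWith _ (members D) (offsets d k) ⟩
    length (members D) · length (offsets d k)  ≡⟨ cong₂ _·_ (length-members D) (length-offsets d k) ⟩
    ∣ D ∣ · geomSum d k                        ∎
    where
    open ℕ.≤-Reasoning
    balls : List (Fin N)
    balls = cartesianProductWith (λ u → uncurry (descendant u)) (members D) (offsets d k)
    covered : ∀ v → v ∈ₗ balls
    covered v with IsDistDom⇒reachable dom v
    ... | u , u∈D , walk with walk⇒descendant walk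
    ... | j , j≤k , t , t<dʲ , refl = ∈-cartesianProductWith⁺ _ (∈-members u∈D) (∈-offsets j≤k t<dʲ)

  hits : ℕ → Fin N → ℕ → Bool
  hits X v q = ((X + q) mod N) ≡ᵇ toℕ v

  ∈-interval⁺ : ∀ X c {q} → q < c → (X + q) modᶠ N ∈ₛ interval N X c
  ∈-interval⁺ X c {q} q<c = lookup⇒[]= v (interval N X c) (begin
    lookup (interval N X c) v  ≡⟨ lookup∘tabulate (λ v → anyBelow c (hits X v)) v ⟩
    anyBelow c (hits X v)      ≡⟨ to T-≡ (anyBelow⁺ (hits X v) q<c X+q-hits-v) ⟩
    true                       ∎)
    where
    open ≡-Reasoning
    v = (X + q) modᶠ N
    X+q-hits-v : T (hits X v q)
    X+q-hits-v = ℕ.≡⇒≡ᵇ _ _ (sym (toℕ-modᶠ (X + q)))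

  ∈-interval⁻ : ∀ X c {v} → v ∈ₛ interval N X c → ∃ λ q → q < c × v ≡ (X + q) modᶠ N
  ∈-interval⁻ X c {v} v∈I =
    let q , q<c , hit = anyBelow⁻ c (hits X v) (from T-≡ (begin
          anyBelow c (hits X v)      ≡⟨ lookup∘tabulate (λ v → anyBelow c (hits X v)) v ⟨
          lookup (interval N X c) v  ≡⟨ []=⇒lookup v∈I ⟩
          true                       ∎))
    in q , q<c , toℕ-injective (trans (sym (ℕ.≡ᵇ⇒≡ _ _ hit)) (sym (toℕ-modᶠ (X + q))))
    where open ≡-Reasoning

  ∣interval∣≤ : ∀ X c → ∣ interval N X c ∣ ≤ c
  ∣interval∣≤ X c = begin
    ∣ interval N X c ∣          ≤⟨ ∣p∣≤length (interval N X c) starts covered ⟩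
    length starts              ≡⟨ length-map _ (upTo c) ⟩
    length (upTo c)            ≡⟨ length-upTo c ⟩
    c                          ∎
    where
    open ℕ.≤-Reasoning
    starts : List (Fin N)
    starts = map (λ q → (X + q) modᶠ N) (upTo c)
    covered : ∀ {v} → v ∈ₛ interval N X c → v ∈ₗ starts
    covered v∈I with ∈-interval⁻ X c v∈I
    ... | q , q<c , refl = ∈-map⁺ _ (∈-upTo⁺ q<c)

  window-reachable : .{{_ : NonZero d}} → ∀ X c {j s} → s < d ^ j · c →
                     ∃ λ u → u ∈ₛ interval N X c × Walk N d j u ((d ^ j · X + s) modᶠ N)
  window-reachable X c {j} {s} s<dʲc =
    u , ∈-interval⁺ X c q<c , subst (Walk N d j u) u→window (descendant-walk u j (m%n<n s e))
    where
    e = d ^ j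
    instance
      e≢0 : NonZero e
      e≢0 = ℕ.m^n≢0 d j
    q = s / e
    q<c : q < c
    q<c = m<n*o⇒m/o<n (subst (s <_) (ℕ.*-comm e c) s<dʲc)
    u = (X + q) modᶠ N
    u→window : descendant u j (s % e) ≡ (e · X + s) modᶠ N
    u→window = modᶠ-cong (begin
      e · toℕ u + s % e          ≈⟨ +-congʳ (s % e) (*-congˡ e (toℕ-modᶠ-≋ (X + q))) ⟩
      e · (X + q) + s % e        ≡⟨ regroup e X q (s % e) ⟩
      e · X + (s % e + q · e)    ≡⟨ cong (_+_ (e · X)) (m≡m%n+[m/n]*n s e) ⟨
      e · X + s                  ∎)
      where
      open ≋-Reasoning
      regroup : ∀ e X q r → e · (X + q) + r ≡ e · X + (r + q · e)
      regroup = solve-∀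

  interval-dominates : .{{_ : NonZero d}} → ∀ {k h c} (x : Fin N) →
    d · toℕ x + h ≋ toℕ x + c → geomSumBelow d k · h + N ≤ geomSum d k · c →
    IsDistDom N d k (interval N (toℕ x) c)
  interval-dominates {k} {h} {c} x shift room v _ =
    let j , j≤k , s , s<dʲc , X+r≋dʲX+s = cover k r r+Bh<Sc
        u , u∈I , walk = window-reachable X c s<dʲc
    in u , u∈I , subst (Walk N d k u) (lands-on-v X+r≋dʲX+s) (walk-mono j≤k walk)
    where
    X = toℕ x
    open Orbit N d X h c shift
    r = toℕ v ∸ₘ X
    r+Bh<Sc : r + geomSumBelow d k · h < geomSum d k · c
    r+Bh<Sc = ℕ.<-≤-trans (ℕ.+-monoˡ-< (geomSumBelow d k · h) (∸ₘ-< (toℕ v) X))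
      (subst (_≤ geomSum d k · c) (ℕ.+-comm (geomSumBelow d k · h) N) room)
    lands-on-v : ∀ {y} → X + r ≋ y → y modᶠ N ≡ v
    lands-on-v X+r≋y = trans (modᶠ-cong (≋-trans (≋-sym X+r≋y) (+-∸ₘ (toℕ v) (ℕ.<⇒≤ (toℕ<n x))))) (modᶠ-toℕ v)

drop-ℤ-bound : ∀ a b c e n → + a * + b ℤ.≤ + c * + e - + n → a · b + n ≤ c · e
drop-ℤ-bound a b c e n ab≤ce-n = drop‿+≤+ (subst₂ ℤ._≤_ lhs≡ rhs≡ (+-monoˡ-≤ (+ n) ab≤ce-n))
  where
  lhs≡ : + a * + b ℤ.+ + n ≡ + (a · b + n)
  lhs≡ = sym (trans (pos-+ (a · b) n) (cong (ℤ._+ + n) (pos-* a b)))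
  cancel : ∀ i j → i - j ℤ.+ j ≡ i
  cancel = ℤ-solve-∀
  rhs≡ : + c * + e - + n ℤ.+ + n ≡ + (c · e)
  rhs≡ = trans (cancel (+ c * + e) (+ n)) (sym (pos-* c e))

0≰pos*neg : ∀ {g} a → 1 ≤ g → ¬ (+ 0 ℤ.≤ + g * -[1+ a ])
0≰pos*neg {suc g} a _ ()

ceilDiv-least : ∀ a S D → 1 ≤ S → a ≤ D · S → ceilDiv a S ≤ D
ceilDiv-least a (suc s) D _ a≤DS = ℕ.<⇒≤pred (m<n*o⇒m/o<n {n = suc D}
  (s≤s (subst (a + s ≤_) (ℕ.+-comm (D · suc s) s) (ℕ.+-monoˡ-≤ s a≤DS))))

minimum-from-bounds : ∀ {n d k c} (I : Subset n) → IsDistDom n d k I → ∣ I ∣ ≤ c →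
  (∀ D → IsDistDom n d k D → c ≤ ∣ D ∣) → GammaEq n d k c × IsMinDistDom n d k I
minimum-from-bounds I I-dom ∣I∣≤c lower =
  ((I , I-dom , ℕ.≤-antisym ∣I∣≤c (lower I I-dom)) , lower) ,
  I-dom , λ D D-dom → ℕ.≤-trans ∣I∣≤c (lower D D-dom)

theorem2p2 : (d n k : ℕ) → 2 Data.Nat.≤ d → d Data.Nat.≤ n → 1 Data.Nat.≤ k →
    (x : Fin n) → (h : ℤ) →
    (+ n) ∣ ((+ (d ∸ 1) * + toℕ x) - (+ ceilDiv n (geomSum d k) - h)) →
    + 0 Data.Integer.≤ + geomSum d (k ∸ 1) * h →
    + geomSum d (k ∸ 1) * h Data.Integer.≤ (+ geomSum d k * + ceilDiv n (geomSum d k)) - + n →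
    GammaEq n d k (ceilDiv n (geomSum d k))
      × IsMinDistDom n d k (interval n (toℕ x) (ceilDiv n (geomSum d k)))
theorem2p2 (suc d) (suc m) (suc k) _ (s≤s _) (s≤s z≤n) x -[1+ a ] _ 0≤Bh _ =
  ⊥-elim (0≰pos*neg a (geomSum-positive (suc d) k) 0≤Bh)
theorem2p2 (suc d) (suc m) (suc k) _ (s≤s _) (s≤s z≤n) x (+ h) N∣shift _ Bh≤Sc-N =
  minimum-from-bounds (interval N (toℕ x) c) (interval-dominates x shift room) (∣interval∣≤ (toℕ x) c) lower
  where
  open DeBruijn m (suc d)
  open Congruence N
  S = geomSum (suc d) (suc k)
  c = ceilDiv N S
  shift : suc d · toℕ x + h ≋ toℕ x + c
  shift = ∣-shift⇒≋ d (toℕ x) c h N∣shift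
  room : geomSumBelow (suc d) (suc k) · h + N ≤ S · c
  room = drop-ℤ-bound (geomSum (suc d) k) h S c N Bh≤Sc-N
  lower : ∀ D → IsDistDom N (suc d) (suc k) D → c ≤ ∣ D ∣
  lower D D-dom = ceilDiv-least N S ∣ D ∣ (geomSum-positive (suc d) (suc k)) (distDom-size D D-dom)
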